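{- Let $G$ be a connected cubic graph that has a spanning $2$-factor all of whose cycles are triangles. Then $Z(G) \le \gamma(G) + 1$.
   Context: All graphs are finite, simple and undirected. A graph is cubic if every vertex has degree $3$. A spanning $2$-factor is a spanning subgraph in which every vertex has degree $2$, i.e., a collection of vertex-disjoint cycles covering all vertices. $\gamma(G)$ is the domination number of $G$: the minimum size of a set $X\subseteq V(G)$ such that every vertex is in $X$ or adjacent to a vertex of $X$. $Z(G)$ is the zero forcing number of $G$. Start with a set $S$ of vertices colored blue and color all other vertices white. Repeatedly apply the following rule: if a blue vertex has exactly one white neighbor, that neighbor becomes blue. $S$ is a zero forcing set if all vertices eventually become blue. $Z(G)$ is the minimum size of a zero forcing set. -}

module Defs where

open import Data.Nat using (ℕ; _≤_; _+_)
open import Data.Bool using (Bool; true; false)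
open import Data.Fin using (Fin)
open import Data.Fin.Subset using (Subset; _∈_; _∉_; _∪_; ⁅_⁆; ⊤; ∣_∣)
open import Data.Vec using (tabulate)
open import Data.Product using (Σ; ∃; _×_; _,_)
open import Data.Sum using (_⊎_)
open import Relation.Binary.PropositionalEquality using (_≡_; _≢_)
open import Relation.Binary.Construct.Closure.ReflexiveTransitive using (Star)

record Graph (n : ℕ) : Set where
  field
    adj    : Fin n → Fin n → Bool
    sym    : ∀ u v → adj u v ≡ adj v u
    irrefl : ∀ v → adj v v ≡ false

module _ {n : ℕ} (G : Graph n) where
  open Graph G

  Adj : Fin n → Fin n → Set
  Adj u v = adj u v ≡ true

  N : Fin n → Subset n
  N v = tabulate (adj v)

  degree : Fin n → ℕ
  degree v = ∣ N v ∣

module _ {n : ℕ} (G : Graph n) where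

  Cubic : Set
  Cubic = ∀ v → degree G v ≡ 3

  Connected : Set
  Connected = ∀ u v → Star (Adj G) u v

  record SpanningSubgraph : Set where
    field
      H    : Graph n
      sub  : ∀ u v → Graph.adj H u v ≡ true → Adj G u v

  record TwoFactor : Set where
    field
      subgraph : SpanningSubgraph
    open SpanningSubgraph subgraph public
    field
      twoRegular : ∀ v → degree H v ≡ 2

  -- every cycle (= component) of the 2-factor is a triangle: in a 2-regular
  -- graph the component of v is a triangle iff the two neighbours of v are adjacent
  AllCyclesTriangles : TwoFactor → Set
  AllCyclesTriangles F =
    ∀ v u w → Adj' v u → Adj' v w → u ≢ w → Adj' u w
    where
      open TwoFactor F
      Adj' = Adj H

  HasTriangle2Factor : Set
  HasTriangle2Factor = Σ TwoFactor AllCyclesTriangles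

  Dominating : Subset n → Set
  Dominating X = ∀ v → v ∈ X ⊎ (∃ λ u → u ∈ X × Adj G u v)

  data Force (B : Subset n) : Subset n → Set where
    force : ∀ v w → v ∈ B → w ∉ B → Adj G v w →
            (∀ x → Adj G v x → x ≢ w → x ∈ B) →
            Force B (B ∪ ⁅ w ⁆)

  ZeroForcing : Subset n → Set
  ZeroForcing S = Star Force S ⊤

  -- Z(G) ≤ γ(G) + 1, stated without minima: for every dominating set X
  -- there is a zero forcing set of size at most |X| + 1
  ZBoundedByDomPlusOne : Set
  ZBoundedByDomPlusOne =
    ∀ X → Dominating X → ∃ λ S → ZeroForcing S × ∣ S ∣ ≤ ∣ X ∣ + 1

{-# OPTIONS --safe #-}
-- Since every cycle of the 2-factor F is a triangle, each vertex v has two neighbours in its own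
-- triangle and exactly one outside it, ext v, and ext is an involution.  Grow a seed set S greedily,
-- closing the blue set under forcing after every addition: then a blue triangle turns the external
-- neighbours of its vertices blue, and a triangle with a blue vertex whose external neighbour is
-- blue turns blue as soon as a second of its vertices does.  Seeds are paid for by the number Ψ of
-- vertices of the dominating set X lying in blue triangles, keeping |S| ≤ 2 + Ψ, and |S| ≤ 1 + Ψ
-- whenever the blue set is clean: no non-blue triangle meeting X is joined to a blue triangle by
-- an external edge.  The first round seeds a whole triangle meeting X; each later round completes
-- one with a single seed if the blue set is not clean, and otherwise with two: by connectivity some
-- non-blue triangle is joined to a blue one, it misses X by cleanliness, so a vertex of it is
-- dominated across its external edge, and seeding that vertex and a mate of its dominator completes
-- both triangles.  If the result is clean, a
-- second vertex of X has been settled.  Once everything is blue the set is clean: |S| ≤ |X| + 1.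
module Submission where

open import Defs
open import Data.Nat using (ℕ)

open import Data.Nat.Base using (zero; suc; _≤_; _<_; _+_; z≤n; s≤s)
open import Data.Nat.Properties
  using (≤-trans; ≤-reflexive; <-≤-trans; <-irrefl; +-mono-≤; +-monoˡ-≤; +-monoʳ-≤; +-suc; +-comm;
         m≤m+n; n≤1+n; n≮0; suc-injective)
open import Data.Bool.Base using (Bool; true)
import Data.Bool.Properties as Bool
open import Data.Fin.Base using (Fin; zero; suc)
open import Data.Fin.Properties using (_≟_; any?; all?; ¬∀⟶∃¬)
open import Data.Fin.Subset
  using (Subset; inside; outside; _∈_; _∉_; _⊆_; _∪_; _∩_; _-_; ⁅_⁆; ⊥; ∣_∣; Nonempty)
open import Data.Fin.Subset.Properties
  using (_∈?_; nonempty?; Empty-unique; ∣⊥∣≡0; ∣p∣≤n; ∣⁅x⁆∣≡1; ∣p∩q∣≤∣p∣; ⊆-antisym; ⊆⊤; ∉⊥;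
         p─⊥≡p; p─q⊆p; x∈p∧x≢y⇒x∈p-y; x∈p⇒∣p-x∣<∣p∣; x∈⁅x⁆; x∈⁅y⁆⇒x≡y; p⊆p∪q; q⊆p∪q;
         x∈p∪q⁻; x∈p∪q⁺; x∈p∩q⁺; x∈p∩q⁻; p⊂q⇒∣p∣<∣q∣)
open import Data.Vec.Base using ([]; _∷_; here; there; tabulate)
open import Data.Vec.Properties using ([]=⇒lookup; lookup⇒[]=; lookup∘tabulate)
open import Data.Product.Base using (∃; ∃₂; _×_; _,_; proj₁; proj₂; map₂; uncurry)
open import Data.Sum.Base using (_⊎_; inj₁; inj₂)
open import Data.Empty using (⊥-elim)
open import Function.Base using (_∘_)
open import Relation.Nullary using (¬_; Dec; does; yes; no; contradiction)
open import Relation.Nullary.Decidable using (dec-true; _×-dec_; _⊎-dec_; _→-dec_; ¬?)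
open import Relation.Binary.PropositionalEquality using (_≡_; _≢_; refl; sym; trans; cong; subst)
open import Relation.Binary.Construct.Closure.ReflexiveTransitive using (Star; ε; _◅_; _◅◅_)

private
  variable
    n : ℕ
    p q : Subset n
    x y : Fin n

∣p∣≡1+∣p-x∣ : x ∈ p → ∣ p ∣ ≡ suc ∣ p - x ∣
∣p∣≡1+∣p-x∣ {p = inside ∷ p} here = cong (suc ∘ ∣_∣) (sym (p─⊥≡p p))
∣p∣≡1+∣p-x∣ {p = outside ∷ p} (there x∈p) = ∣p∣≡1+∣p-x∣ x∈p
∣p∣≡1+∣p-x∣ {p = inside ∷ p} (there x∈p) = cong suc (∣p∣≡1+∣p-x∣ x∈p)

∣p-x∣≡k : ∀ {k} → ∣ p ∣ ≡ suc k → x ∈ p → ∣ p - x ∣ ≡ k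
∣p-x∣≡k ∣p∣≡1+k x∈p = suc-injective (trans (sym (∣p∣≡1+∣p-x∣ x∈p)) ∣p∣≡1+k)

x∈p-y⇒x≢y : x ∈ p - y → x ≢ y
x∈p-y⇒x≢y {x = zero}  {p = _ ∷ _} {y = zero}  ()
x∈p-y⇒x≢y {x = suc x} {p = _ ∷ _} {y = suc y} (there x∈p-y) refl = x∈p-y⇒x≢y x∈p-y refl
x∈p-y⇒x≢y {x = zero}  {y = suc y} _ ()
x∈p-y⇒x≢y {x = suc x} {y = zero}  _ ()

∣p∣≡suc⇒nonempty : ∀ {n k} {p : Subset n} → ∣ p ∣ ≡ suc k → Nonempty p
∣p∣≡suc⇒nonempty {n} {p = p} ∣p∣≡1+k with nonempty? p
... | yes ne = ne
... | no ¬ne with () ← trans (sym ∣p∣≡1+k) (trans (cong ∣_∣ (Empty-unique ¬ne)) (∣⊥∣≡0 n))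

∣p∣≡1⇒≡ : ∣ p ∣ ≡ 1 → x ∈ p → y ∈ p → y ≡ x
∣p∣≡1⇒≡ {x = x} {y} ∣p∣≡1 x∈p y∈p with y ≟ x
... | yes y≡x = y≡x
... | no y≢x = contradiction (x∈p⇒∣p-x∣<∣p∣ (x∈p∧x≢y⇒x∈p-y y∈p y≢x))
                            (λ lt → n≮0 (<-≤-trans lt (≤-reflexive (∣p-x∣≡k ∣p∣≡1 x∈p))))

∣p∪q∣≤∣p∣+∣q∣ : ∀ (p q : Subset n) → ∣ p ∪ q ∣ ≤ ∣ p ∣ + ∣ q ∣
∣p∪q∣≤∣p∣+∣q∣ []            []            = z≤n
∣p∪q∣≤∣p∣+∣q∣ (outside ∷ p) (outside ∷ q) = ∣p∪q∣≤∣p∣+∣q∣ p q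
∣p∪q∣≤∣p∣+∣q∣ (inside  ∷ p) (outside ∷ q) = s≤s (∣p∪q∣≤∣p∣+∣q∣ p q)
∣p∪q∣≤∣p∣+∣q∣ (outside ∷ p) (inside  ∷ q) =
  ≤-trans (s≤s (∣p∪q∣≤∣p∣+∣q∣ p q)) (≤-reflexive (sym (+-suc ∣ p ∣ ∣ q ∣)))
∣p∪q∣≤∣p∣+∣q∣ (inside  ∷ p) (inside  ∷ q) =
  s≤s (≤-trans (∣p∪q∣≤∣p∣+∣q∣ p q) (≤-trans (n≤1+n _) (≤-reflexive (sym (+-suc ∣ p ∣ ∣ q ∣)))))

∣⁅x⁆∪p∣≤1+∣p∣ : ∀ x (p : Subset n) → ∣ ⁅ x ⁆ ∪ p ∣ ≤ suc ∣ p ∣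
∣⁅x⁆∪p∣≤1+∣p∣ x p = ≤-trans (∣p∪q∣≤∣p∣+∣q∣ ⁅ x ⁆ p) (≤-reflexive (cong (_+ ∣ p ∣) (∣⁅x⁆∣≡1 x)))

∣⁅x⁆∪⁅y⁆∣≤2 : ∀ (x y : Fin n) → ∣ ⁅ x ⁆ ∪ ⁅ y ⁆ ∣ ≤ 2
∣⁅x⁆∪⁅y⁆∣≤2 x y = ≤-trans (∣⁅x⁆∪p∣≤1+∣p∣ x ⁅ y ⁆) (s≤s (≤-reflexive (∣⁅x⁆∣≡1 y)))

x∈p⇒⁅x⁆⊆p : x ∈ p → ⁅ x ⁆ ⊆ p
x∈p⇒⁅x⁆⊆p {x = x} {p} x∈p y∈⁅x⁆ = subst (_∈ p) (sym (x∈⁅y⁆⇒x≡y x y∈⁅x⁆)) x∈p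

∪-lub : p ⊆ q → ∀ {r} → r ⊆ q → p ∪ r ⊆ q
∪-lub {p = p} p⊆q {r} r⊆q x∈p∪r with x∈p∪q⁻ p r x∈p∪r
... | inj₁ x∈p = p⊆q x∈p
... | inj₂ x∈r = r⊆q x∈r

2+∣p∣≤∣q∣ : p ⊆ q → x ≢ y → x ∉ p → y ∉ p → x ∈ q → y ∈ q → 2 + ∣ p ∣ ≤ ∣ q ∣
2+∣p∣≤∣q∣ {p = p} {x = x} p⊆q x≢y x∉p y∉p x∈q y∈q =
  ≤-trans (s≤s (p⊂q⇒∣p∣<∣q∣ (p⊆p∪q ⁅ x ⁆ , x , q⊆p∪q p ⁅ x ⁆ (x∈⁅x⁆ x) , x∉p)))
          (p⊂q⇒∣p∣<∣q∣ (∪-lub p⊆q (x∈p⇒⁅x⁆⊆p x∈q) , _ , y∈q , y∉p∪⁅x⁆))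
  where
  y∉p∪⁅x⁆ : _ ∉ p ∪ ⁅ x ⁆
  y∉p∪⁅x⁆ y∈p∪⁅x⁆ with x∈p∪q⁻ p ⁅ x ⁆ y∈p∪⁅x⁆
  ... | inj₁ y∈p = y∉p y∈p
  ... | inj₂ y∈⁅x⁆ = x≢y (sym (x∈⁅y⁆⇒x≡y x y∈⁅x⁆))

crossing-edge : ∀ {a r ℓ} {A : Set a} {R : A → A → Set r} {P : A → Set ℓ} → (∀ x → Dec (P x)) →
                ∀ {x y} → Star R x y → P x → ¬ P y → ∃₂ λ u v → R u v × P u × ¬ P v
crossing-edge P? ε Px ¬Py = contradiction Px ¬Py
crossing-edge P? (_◅_ {j = z} xz z⋆y) Px ¬Py with P? z
... | yes Pz = crossing-edge P? z⋆y Pz ¬Py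
... | no ¬Pz = _ , z , xz , Px , ¬Pz

climb : ∀ {a ℓ} {A : Set a} {P Q : A → Set ℓ} (μ : A → ℕ) (m : ℕ) → (∀ s → μ s ≤ m) →
        (∀ {s} → P s → Q s ⊎ ∃ λ t → P t × μ s < μ t) →
        ∀ {s} → P s → ∃ λ t → P t × Q t
climb {P = P} {Q} μ m μ≤m step {s} Ps = go m (m≤m+n m (μ s)) Ps
  where
  go : ∀ k {s} → m ≤ k + μ s → P s → ∃ λ t → P t × Q t
  go k {s} m≤k+μs Ps with step Ps
  ... | inj₁ Qs = s , Ps , Qs
  go zero    m≤μs   _ | inj₂ (t , _ , μs<μt) =
    ⊥-elim (<-irrefl refl (<-≤-trans μs<μt (≤-trans (μ≤m t) m≤μs)))
  go (suc k) m≤k+μs _ | inj₂ (t , Pt , μs<μt) =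
    go k (≤-trans m≤k+μs (≤-trans (≤-reflexive (sym (+-suc k (μ _)))) (+-monoʳ-≤ k μs<μt))) Pt

∈tabulate⁺ : ∀ (f : Fin n → Bool) → f x ≡ true → x ∈ tabulate f
∈tabulate⁺ {x = x} f fx = lookup⇒[]= x (tabulate f) (trans (lookup∘tabulate f x) fx)

∈tabulate⁻ : ∀ (f : Fin n → Bool) → x ∈ tabulate f → f x ≡ true
∈tabulate⁻ {x = x} f x∈tf = trans (sym (lookup∘tabulate f x)) ([]=⇒lookup x∈tf)

does≡true⇒ : ∀ {a} {A : Set a} (a? : Dec A) → does a? ≡ true → A
does≡true⇒ (yes a) _ = a

module _ (G : Graph n) where
  open Graph G using (adj)

  Adj⇒∈N : ∀ {v u} → Adj G v u → u ∈ N G v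
  Adj⇒∈N {v} = ∈tabulate⁺ (adj v)

  ∈N⇒Adj : ∀ {v u} → u ∈ N G v → Adj G v u
  ∈N⇒Adj {v} = ∈tabulate⁻ (adj v)

  Adj-sym : ∀ {u v} → Adj G u v → Adj G v u
  Adj-sym {u} {v} uv = trans (Graph.sym G v u) uv

  Adj⇒≢ : ∀ {u v} → Adj G u v → u ≢ v
  Adj⇒≢ {u} uu refl with () ← trans (sym uu) (Graph.irrefl G u)

  Adj? : ∀ u v → Dec (Adj G u v)
  Adj? u v = adj u v Bool.≟ true

module ZeroForcingProcess (G : Graph n) where

  Stalled : Subset n → Set
  Stalled B = ∀ v w → v ∈ B → w ∉ B → Adj G v w → ¬ (∀ x → Adj G v x → x ≢ w → x ∈ B)

  infix 4 _⇒*_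
  _⇒*_ : Subset n → Subset n → Set
  _⇒*_ = Star (Force G)

  ⇒*-⊆ : ∀ {B C} → B ⇒* C → B ⊆ C
  ⇒*-⊆ ε                        = λ x∈B → x∈B
  ⇒*-⊆ (force _ w _ _ _ _ ◅ B⇒*C) = ⇒*-⊆ B⇒*C ∘ p⊆p∪q ⁅ w ⁆

  force-grows : ∀ {B C} → Force G B C → ∣ B ∣ < ∣ C ∣
  force-grows {B} (force _ w _ w∉B _ _) = p⊂q⇒∣p∣<∣q∣ (p⊆p∪q ⁅ w ⁆ , w , q⊆p∪q B ⁅ w ⁆ (x∈⁅x⁆ w) , w∉B)

  force-or-stalled : ∀ B → (∃ λ C → Force G B C) ⊎ Stalled B
  force-or-stalled B with any? (λ v → any? (λ w → forcing? v w))
    where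
    forcing? : ∀ v w → Dec (v ∈ B × w ∉ B × Adj G v w × (∀ x → Adj G v x → x ≢ w → x ∈ B))
    forcing? v w = v ∈? B ×-dec ¬? (w ∈? B) ×-dec Adj? G v w ×-dec
                   all? (λ x → Adj? G v x →-dec (¬? (x ≟ w) →-dec x ∈? B))
  ... | yes (v , w , v∈B , w∉B , vw , others) = inj₁ (_ , force v w v∈B w∉B vw others)
  ... | no ¬forcing = inj₂ λ v w v∈B w∉B vw others → ¬forcing (v , w , v∈B , w∉B , vw , others)

  stabilise : ∀ B → ∃ λ C → B ⇒* C × Stalled C
  stabilise B = climb ∣_∣ n ∣p∣≤n step ε
    where
    step : ∀ {C} → B ⇒* C → Stalled C ⊎ ∃ λ D → B ⇒* D × ∣ C ∣ < ∣ D ∣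
    step {C} B⇒*C with force-or-stalled C
    ... | inj₁ (D , C⇒D) = inj₂ (D , B⇒*C ◅◅ (C⇒D ◅ ε) , force-grows C⇒D)
    ... | inj₂ stalled   = inj₁ stalled

  ⇒*-mono : ∀ {B C B′} → B ⇒* C → B ⊆ B′ → ∃ λ C′ → B′ ⇒* C′ × C ⊆ C′
  ⇒*-mono {B′ = B′} ε B⊆B′ = B′ , ε , B⊆B′
  ⇒*-mono {B′ = B′} (force v w v∈B w∉B vw others ◅ B⇒*C) B⊆B′ with w ∈? B′
  ... | yes w∈B′ = ⇒*-mono B⇒*C (∪-lub B⊆B′ (x∈p⇒⁅x⁆⊆p w∈B′))
  ... | no w∉B′ with ⇒*-mono B⇒*C (∪-lub (p⊆p∪q ⁅ w ⁆ ∘ B⊆B′) (q⊆p∪q B′ ⁅ w ⁆))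
  ...   | C′ , B′∪w⇒*C′ , C⊆C′ =
    C′ , force v w (B⊆B′ v∈B) w∉B′ vw (λ x vx x≢w → B⊆B′ (others x vx x≢w)) ◅ B′∪w⇒*C′ , C⊆C′

  add-and-stabilise : ∀ {S B} → S ⇒* B → ∀ A →
                      ∃ λ B′ → A ∪ S ⇒* B′ × Stalled B′ × B ⊆ B′ × A ⊆ B′
  add-and-stabilise {S} S⇒*B A with ⇒*-mono S⇒*B (q⊆p∪q A S)
  ... | C , A∪S⇒*C , B⊆C with stabilise C
  ...   | B′ , C⇒*B′ , stalled =
    B′ , A∪S⇒*C ◅◅ C⇒*B′ , stalled , ⇒*-⊆ C⇒*B′ ∘ B⊆C , ⇒*-⊆ (A∪S⇒*C ◅◅ C⇒*B′) ∘ p⊆p∪q S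

module TriangleFactor (G : Graph n) (cubic : Cubic G) (F : TwoFactor G)
                      (triangles : AllCyclesTriangles G F) where
  open TwoFactor F using (H; sub; twoRegular)

  -- Opaque: only the specifications below are used, and unfolding the witnesses is very expensive.
  private
    mate₁-witness : ∀ v → Nonempty (N H v)
    mate₁-witness v = ∣p∣≡suc⇒nonempty (twoRegular v)

  opaque
    mate₁ : Fin n → Fin n
    mate₁ v = proj₁ (mate₁-witness v)

    mate₁∈N : ∀ v → mate₁ v ∈ N H v
    mate₁∈N v = proj₂ (mate₁-witness v)

  private
    mate₂-witness : ∀ v → Nonempty (N H v - mate₁ v)
    mate₂-witness v = ∣p∣≡suc⇒nonempty (∣p-x∣≡k (twoRegular v) (mate₁∈N v))

  opaque
    mate₂ : Fin n → Fin n
    mate₂ v = proj₁ (mate₂-witness v)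

    mate₂∈N-mate₁ : ∀ v → mate₂ v ∈ N H v - mate₁ v
    mate₂∈N-mate₁ v = proj₂ (mate₂-witness v)

  mate₁-adj : ∀ v → Adj H v (mate₁ v)
  mate₁-adj v = ∈N⇒Adj H (mate₁∈N v)

  mate₂-adj : ∀ v → Adj H v (mate₂ v)
  mate₂-adj v = ∈N⇒Adj H (p─q⊆p (N H v) ⁅ mate₁ v ⁆ (mate₂∈N-mate₁ v))

  mate₂≢mate₁ : ∀ v → mate₂ v ≢ mate₁ v
  mate₂≢mate₁ v = x∈p-y⇒x≢y (mate₂∈N-mate₁ v)

  H-adj-other-unique : ∀ {v u w x} → Adj H v u → Adj H v w → Adj H v x → w ≢ u → x ≢ u → x ≡ w
  H-adj-other-unique {v} vu vw vx w≢u x≢u =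
    ∣p∣≡1⇒≡ (∣p-x∣≡k (twoRegular v) (Adj⇒∈N H vu)) (x∈p∧x≢y⇒x∈p-y (Adj⇒∈N H vw) w≢u)
                                                 (x∈p∧x≢y⇒x∈p-y (Adj⇒∈N H vx) x≢u)

  H-adj-cases : ∀ {v u} → Adj H v u → u ≡ mate₁ v ⊎ u ≡ mate₂ v
  H-adj-cases {v} {u} vu with u ≟ mate₁ v
  ... | yes u≡mate₁ = inj₁ u≡mate₁
  ... | no  u≢mate₁ = inj₂ (H-adj-other-unique (mate₁-adj v) (mate₂-adj v) vu (mate₂≢mate₁ v) u≢mate₁)

  private
    outside-H : Fin n → Subset n
    outside-H v = N G v - mate₁ v - mate₂ v

    ∣outside-H∣≡1 : ∀ v → ∣ outside-H v ∣ ≡ 1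
    ∣outside-H∣≡1 v = ∣p-x∣≡k (∣p-x∣≡k (cubic v) (Adj⇒∈N G (sub _ _ (mate₁-adj v))))
                              (x∈p∧x≢y⇒x∈p-y (Adj⇒∈N G (sub _ _ (mate₂-adj v))) (mate₂≢mate₁ v))

    ext-witness : ∀ v → Nonempty (outside-H v)
    ext-witness v = ∣p∣≡suc⇒nonempty (∣outside-H∣≡1 v)

  opaque
    ext : Fin n → Fin n
    ext v = proj₁ (ext-witness v)

    ext∈outside-H : ∀ v → ext v ∈ outside-H v
    ext∈outside-H v = proj₂ (ext-witness v)

  ext-adj : ∀ v → Adj G v (ext v)
  ext-adj v = ∈N⇒Adj G (p─q⊆p _ _ (p─q⊆p _ _ (ext∈outside-H v)))

  ext-not-H : ∀ v → ¬ Adj H v (ext v)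
  ext-not-H v v-ext with H-adj-cases v-ext
  ... | inj₁ ext≡mate₁ = x∈p-y⇒x≢y (p─q⊆p _ _ (ext∈outside-H v)) ext≡mate₁
  ... | inj₂ ext≡mate₂ = x∈p-y⇒x≢y (ext∈outside-H v) ext≡mate₂

  G-adj-cases : ∀ {v u} → Adj G v u → Adj H v u ⊎ u ≡ ext v
  G-adj-cases {v} {u} vu with Adj? H v u
  ... | yes vu-in-H = inj₁ vu-in-H
  ... | no  vu-not-H =
    inj₂ (∣p∣≡1⇒≡ (∣outside-H∣≡1 v) (ext∈outside-H v)
                  (x∈p∧x≢y⇒x∈p-y (x∈p∧x≢y⇒x∈p-y (Adj⇒∈N G vu) (avoid (mate₁-adj v))) (avoid (mate₂-adj v))))
    where
    avoid : ∀ {w} → Adj H v w → u ≢ w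
    avoid vw refl = vu-not-H vw

  ext-involutive : ∀ v → ext (ext v) ≡ v
  ext-involutive v with G-adj-cases (Adj-sym G (ext-adj v))
  ... | inj₁ ext-v-in-H = contradiction (Adj-sym H ext-v-in-H) (ext-not-H v)
  ... | inj₂ v≡ext-ext  = sym v≡ext-ext

  -- u and v lie on the same triangle of F
  infix 4 _∼_
  _∼_ : Fin n → Fin n → Set
  u ∼ v = u ≡ v ⊎ Adj H u v

  ∼-refl : ∀ {v} → v ∼ v
  ∼-refl = inj₁ refl

  ∼-sym : ∀ {u v} → u ∼ v → v ∼ u
  ∼-sym (inj₁ refl) = inj₁ refl
  ∼-sym (inj₂ uv)   = inj₂ (Adj-sym H uv)

  ∼-trans : ∀ {u v w} → u ∼ v → v ∼ w → u ∼ w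
  ∼-trans (inj₁ refl) v∼w = v∼w
  ∼-trans u∼v (inj₁ refl) = u∼v
  ∼-trans {u} {v} {w} (inj₂ uv) (inj₂ vw) with w ≟ u
  ... | yes w≡u = inj₁ (sym w≡u)
  ... | no  w≢u = inj₂ (triangles v u w (Adj-sym H uv) vw (w≢u ∘ sym))

  ∼? : ∀ u v → Dec (u ∼ v)
  ∼? u v = u ≟ v ⊎-dec Adj? H u v

  ∼-mate₁ : ∀ v → v ∼ mate₁ v
  ∼-mate₁ v = inj₂ (mate₁-adj v)

  ∼-mate₂ : ∀ v → v ∼ mate₂ v
  ∼-mate₂ v = inj₂ (mate₂-adj v)

  ∼-cases : ∀ {v u} → v ∼ u → u ≡ v ⊎ u ≡ mate₁ v ⊎ u ≡ mate₂ v
  ∼-cases (inj₁ v≡u) = inj₁ (sym v≡u)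
  ∼-cases (inj₂ vu)  = inj₂ (H-adj-cases vu)

  ≁-ext : ∀ v → ¬ v ∼ ext v
  ≁-ext v (inj₁ v≡ext) = Adj⇒≢ G (ext-adj v) v≡ext
  ≁-ext v (inj₂ v-ext) = ext-not-H v v-ext

  open ZeroForcingProcess G

  Blue : Subset n → Fin n → Set
  Blue B v = ∀ u → v ∼ u → u ∈ B

  blue? : ∀ B v → Dec (Blue B v)
  blue? B v = all? (λ u → ∼? v u →-dec u ∈? B)

  blue-intro : ∀ {B v} → v ∈ B → mate₁ v ∈ B → mate₂ v ∈ B → Blue B v
  blue-intro v∈B mate₁∈B mate₂∈B _ v∼u with ∼-cases v∼u
  ... | inj₁ refl         = v∈B
  ... | inj₂ (inj₁ refl) = mate₁∈B
  ... | inj₂ (inj₂ refl) = mate₂∈B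

  Blue-resp-∼ : ∀ {B u v} → u ∼ v → Blue B u → Blue B v
  Blue-resp-∼ u∼v blue w v∼w = blue w (∼-trans u∼v v∼w)

  stalled⇒ext∈ : ∀ {B v} → Stalled B → Blue B v → ext v ∈ B
  stalled⇒ext∈ {B} {v} stalled blue with ext v ∈? B
  ... | yes ext∈B = ext∈B
  ... | no  ext∉B = contradiction others (stalled v (ext v) (blue v ∼-refl) ext∉B (ext-adj v))
    where
    others : ∀ x → Adj G v x → x ≢ ext v → x ∈ B
    others x vx x≢ext with G-adj-cases vx
    ... | inj₁ vx-in-H = blue x (inj₂ vx-in-H)
    ... | inj₂ x≡ext   = contradiction x≡ext x≢ext

  stalled-fill : ∀ {B v u} → Stalled B → v ∈ B → ext v ∈ B → Adj H v u → u ∈ B → Blue B v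
  stalled-fill {B} {v} {u} stalled v∈B ext∈B vu u∈B _ (inj₁ refl) = v∈B
  stalled-fill {B} {v} {u} stalled v∈B ext∈B vu u∈B w (inj₂ vw) with w ≟ u | w ∈? B
  ... | yes refl | _       = u∈B
  ... | no  _    | yes w∈B = w∈B
  ... | no  w≢u  | no  w∉B = contradiction others (stalled v w v∈B w∉B (sub _ _ vw))
    where
    others : ∀ x → Adj G v x → x ≢ w → x ∈ B
    others x vx x≢w with G-adj-cases vx | x ≟ u
    ... | inj₂ refl   | _        = ext∈B
    ... | inj₁ _      | yes refl = u∈B
    ... | inj₁ vx-in-H | no x≢u  = contradiction (H-adj-other-unique vu vw vx-in-H w≢u x≢u) x≢w

module Domination (G : Graph n) (cubic : Cubic G) (F : TwoFactor G)
                  (triangles : AllCyclesTriangles G F) (X : Subset n) (dom : Dominating G X) where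
  open TwoFactor F using (H)
  open TriangleFactor G cubic F triangles
  open ZeroForcingProcess G

  MeetsX : Fin n → Set
  MeetsX v = ∃ λ z → v ∼ z × z ∈ X

  meetsX? : ∀ v → Dec (MeetsX v)
  meetsX? v = any? (λ z → ∼? v z ×-dec z ∈? X)

  meetsX⊎ext∈X : ∀ v → MeetsX v ⊎ ext v ∈ X
  meetsX⊎ext∈X v with dom v
  ... | inj₁ v∈X = inj₁ (v , ∼-refl , v∈X)
  ... | inj₂ (z , z∈X , zv) with G-adj-cases (Adj-sym G zv)
  ...   | inj₁ vz-in-H = inj₁ (z , inj₂ vz-in-H , z∈X)
  ...   | inj₂ refl    = inj₂ z∈X

  ∉X⇒ext-meetsX : ∀ {a} → a ∉ X → MeetsX (ext a)
  ∉X⇒ext-meetsX {a} a∉X with meetsX⊎ext∈X (ext a)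
  ... | inj₁ meets = meets
  ... | inj₂ ext-ext∈X = contradiction (subst (_∈ X) (ext-involutive a) ext-ext∈X) a∉X

  X-member : Fin n → ∃ (_∈ X)
  X-member w with dom w
  ... | inj₁ w∈X           = w , w∈X
  ... | inj₂ (z , z∈X , _) = z , z∈X

  Clean : Subset n → Set
  Clean B = ∀ p → MeetsX p → Blue B (ext p) → Blue B p

  settled : Subset n → Subset n
  settled B = X ∩ tabulate (λ v → does (blue? B v))

  settled⁺ : ∀ {B x} → x ∈ X → Blue B x → x ∈ settled B
  settled⁺ {B} {x} x∈X blue = x∈p∩q⁺ (x∈X , ∈tabulate⁺ (λ v → does (blue? B v)) (dec-true (blue? B x) blue))

  settled⁻ : ∀ {B x} → x ∈ settled B → Blue B x
  settled⁻ {B} {x} x∈settled =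
    does≡true⇒ (blue? B x) (∈tabulate⁻ (λ v → does (blue? B v)) (proj₂ (x∈p∩q⁻ X _ x∈settled)))

  settled-mono : ∀ {B B′} → B ⊆ B′ → settled B ⊆ settled B′
  settled-mono B⊆B′ x∈settled =
    settled⁺ (proj₁ (x∈p∩q⁻ X _ x∈settled)) (λ u x∼u → B⊆B′ (settled⁻ x∈settled u x∼u))

  clean-or-unclean : ∀ B → Clean B ⊎ ∃ λ p → MeetsX p × ¬ Blue B p × Blue B (ext p)
  clean-or-unclean B with any? (λ p → meetsX? p ×-dec ¬? (blue? B p) ×-dec blue? B (ext p))
  ... | yes unclean = inj₂ unclean
  ... | no ¬unclean = inj₁ clean
    where
    clean : Clean B
    clean p meets blue-ext with blue? B p
    ... | yes blue = blue
    ... | no ¬blue = contradiction (p , meets , ¬blue , blue-ext) ¬unclean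

  Settles : Subset n → Subset n → Fin n → Set
  Settles B B′ x = x ∈ X × ¬ Blue B x × Blue B′ x

  settled-grows : ∀ {B B′ x} → B ⊆ B′ → Settles B B′ x → ∣ settled B ∣ < ∣ settled B′ ∣
  settled-grows B⊆B′ (x∈X , ¬blue , blue′) =
    p⊂q⇒∣p∣<∣q∣ (settled-mono B⊆B′ , _ , settled⁺ x∈X blue′ , ¬blue ∘ settled⁻)

  settled-grows₂ : ∀ {B B′ x y} → B ⊆ B′ → Settles B B′ x → Settles B B′ y → x ≢ y →
                   2 + ∣ settled B ∣ ≤ ∣ settled B′ ∣
  settled-grows₂ B⊆B′ (x∈X , ¬blue-x , blue′-x) (y∈X , ¬blue-y , blue′-y) x≢y =
    2+∣p∣≤∣q∣ (settled-mono B⊆B′) x≢y (¬blue-x ∘ settled⁻) (¬blue-y ∘ settled⁻)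
              (settled⁺ x∈X blue′-x) (settled⁺ y∈X blue′-y)

  Settles-resp-∼ : ∀ {B B′ x t} → x ∼ t → t ∈ X → Settles B B′ x → Settles B B′ t
  Settles-resp-∼ x∼t t∈X (_ , ¬blue , blue′) =
    t∈X , ¬blue ∘ Blue-resp-∼ (∼-sym x∼t) , Blue-resp-∼ x∼t blue′

  settles-across : ∀ {B B′ x t} → Clean B′ → x ∼ t → t ∉ X → Blue B′ x → ¬ Blue B (ext t) →
                   ∃ λ y → y ≢ x × Settles B B′ y
  settles-across {B′ = B′} {x} {t} clean′ x∼t t∉X blue′ ¬blue-ext with ∉X⇒ext-meetsX t∉X
  ... | z , ext∼z , z∈X = z , z≢x , z∈X , ¬blue-ext ∘ Blue-resp-∼ (∼-sym ext∼z) , Blue-resp-∼ ext∼z blue′-ext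
    where
    blue′-ext : Blue B′ (ext t)
    blue′-ext = clean′ (ext t) (∉X⇒ext-meetsX t∉X)
                       (subst (Blue B′) (sym (ext-involutive t)) (Blue-resp-∼ x∼t blue′))
    z≢x : z ≢ x
    z≢x refl = ≁-ext t (∼-sym (∼-trans ext∼z x∼t))

  -- A mate t ∉ X of x is dominated from the triangle of ext t, which is blue in the clean B′; if
  -- both such triangles were already blue in the stalled B, so would be the triangle of x.
  clean-settles-another : ∀ {B B′ x} → Stalled B → Clean B′ → Settles B B′ x →
                          ∃ λ y → y ≢ x × Settles B B′ y
  clean-settles-another {B} {B′} {x} stalled clean′ settles@(x∈X , ¬blue , blue′)
    with mate₁ x ∈? X | mate₂ x ∈? X
  ... | yes a∈X | _       = mate₁ x , Adj⇒≢ H (mate₁-adj x) ∘ sym , Settles-resp-∼ (∼-mate₁ x) a∈X settles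
  ... | no  _   | yes b∈X = mate₂ x , Adj⇒≢ H (mate₂-adj x) ∘ sym , Settles-resp-∼ (∼-mate₂ x) b∈X settles
  ... | no  a∉X | no  b∉X with blue? B (ext (mate₁ x)) | blue? B (ext (mate₂ x))
  ...   | no ¬blue-ext-a | _               = settles-across clean′ (∼-mate₁ x) a∉X blue′ ¬blue-ext-a
  ...   | yes _          | no ¬blue-ext-b = settles-across clean′ (∼-mate₂ x) b∉X blue′ ¬blue-ext-b
  ...   | yes blue-ext-a | yes blue-ext-b  = contradiction (Blue-resp-∼ (∼-sym (∼-mate₁ x)) blue-a) ¬blue
    where
    ∈B : ∀ {t} → Blue B (ext t) → t ∈ B
    ∈B {t} blue-ext-t = subst (_∈ B) (ext-involutive t) (stalled⇒ext∈ stalled blue-ext-t)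
    blue-a : Blue B (mate₁ x)
    blue-a = stalled-fill stalled (∈B blue-ext-a) (blue-ext-a _ ∼-refl)
               (triangles x (mate₁ x) (mate₂ x) (mate₁-adj x) (mate₂-adj x) (mate₂≢mate₁ x ∘ sym))
               (∈B blue-ext-b)

module Construction (G : Graph n) (connected : Connected G) (cubic : Cubic G) (F : TwoFactor G)
                 (triangles : AllCyclesTriangles G F) (X : Subset n) (dom : Dominating G X) where
  open TriangleFactor G cubic F triangles
  open ZeroForcingProcess G
  open Domination G cubic F triangles X dom

  record Progress (S B : Subset n) : Set where
    field
      forcing      : S ⇒* B
      stalled      : Stalled B
      some-blue    : ∃ (Blue B)
      budget       : ∣ S ∣ ≤ 2 + ∣ settled B ∣
      budget-clean : Clean B → ∣ S ∣ ≤ 1 + ∣ settled B ∣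

  State : Set
  State = Subset n × Subset n

  potential : State → ℕ
  potential (_ , B) = ∣ settled B ∣

  Advanced : Subset n → Set
  Advanced B = ∃ λ t → uncurry Progress t × ∣ settled B ∣ < potential t

  -- The new blue set settles x, and a second vertex of X if it is clean; hence the budget 3 + Ψ.
  advance : ∀ {S B x} → S ⇒* B → Stalled B → (A : Subset n) → ∣ A ∣ + ∣ S ∣ ≤ 3 + ∣ settled B ∣ →
            x ∈ X → ¬ Blue B x → (∀ {B′} → Stalled B′ → B ⊆ B′ → A ⊆ B′ → Blue B′ x) → Advanced B
  advance {S} {B} {x} S⇒*B stalled A affordable x∈X ¬blue blue′ with add-and-stabilise S⇒*B A
  ... | B′ , A∪S⇒*B′ , stalled′ , B⊆B′ , A⊆B′ =
    (A ∪ S , B′) , progress , settled-grows B⊆B′ settles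
    where
    settles : Settles B B′ x
    settles = x∈X , ¬blue , blue′ stalled′ B⊆B′ A⊆B′
    cost : ∣ A ∪ S ∣ ≤ 3 + ∣ settled B ∣
    cost = ≤-trans (∣p∪q∣≤∣p∣+∣q∣ A S) affordable
    budget-clean : Clean B′ → ∣ A ∪ S ∣ ≤ 1 + ∣ settled B′ ∣
    budget-clean clean′ with clean-settles-another stalled clean′ settles
    ... | y , y≢x , settles-y = ≤-trans cost (s≤s (settled-grows₂ B⊆B′ settles settles-y (y≢x ∘ sym)))
    progress : Progress (A ∪ S) B′
    progress = record
      { forcing      = A∪S⇒*B′
      ; stalled      = stalled′
      ; some-blue    = x , proj₂ (proj₂ settles)
      ; budget       = ≤-trans cost (s≤s (s≤s (settled-grows B⊆B′ settles)))
      ; budget-clean = budget-clean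
      }

  start : ∀ {x} → x ∈ X → ∃ (uncurry Progress)
  start {x} x∈X =
    map₂ proj₁ (advance ε stalled-⊥ triangle affordable x∈X (λ blue → ∉⊥ (blue x ∼-refl)) blue′)
    where
    triangle : Subset n
    triangle = ⁅ x ⁆ ∪ ⁅ mate₁ x ⁆ ∪ ⁅ mate₂ x ⁆
    stalled-⊥ : Stalled ⊥
    stalled-⊥ v _ v∈⊥ = contradiction v∈⊥ ∉⊥
    affordable : ∣ triangle ∣ + ∣ ⊥ {n = n} ∣ ≤ 3 + ∣ settled ⊥ ∣
    affordable = +-mono-≤ (≤-trans (∣⁅x⁆∪p∣≤1+∣p∣ x _) (s≤s (∣⁅x⁆∪⁅y⁆∣≤2 (mate₁ x) (mate₂ x))))
                          (≤-trans (≤-reflexive (∣⊥∣≡0 n)) z≤n)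
    blue′ : ∀ {B′} → Stalled B′ → ⊥ ⊆ B′ → triangle ⊆ B′ → Blue B′ x
    blue′ _ _ triangle⊆B′ = blue-intro (triangle⊆B′ (x∈p∪q⁺ (inj₁ (x∈⁅x⁆ x))))
                                       (triangle⊆B′ (x∈p∪q⁺ (inj₂ (x∈p∪q⁺ (inj₁ (x∈⁅x⁆ (mate₁ x)))))))
                                       (triangle⊆B′ (x∈p∪q⁺ (inj₂ (x∈p∪q⁺ (inj₂ (x∈⁅x⁆ (mate₂ x)))))))

  absorb : ∀ {S B p} → Progress S B → MeetsX p → ¬ Blue B p → Blue B (ext p) → Advanced B
  absorb {S} {B} {p} progress (z , p∼z , z∈X) ¬blue blue-ext =
    advance forcing stalled ⁅ mate₁ p ⁆ affordable z∈X (¬blue ∘ Blue-resp-∼ (∼-sym p∼z)) blue′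
    where
    open Progress progress
    affordable : ∣ ⁅ mate₁ p ⁆ ∣ + ∣ S ∣ ≤ 3 + ∣ settled B ∣
    affordable = ≤-trans (+-monoˡ-≤ ∣ S ∣ (≤-reflexive (∣⁅x⁆∣≡1 (mate₁ p)))) (s≤s budget)
    p∈B : p ∈ B
    p∈B = subst (_∈ B) (ext-involutive p) (stalled⇒ext∈ stalled blue-ext)
    blue′ : ∀ {B′} → Stalled B′ → B ⊆ B′ → ⁅ mate₁ p ⁆ ⊆ B′ → Blue B′ z
    blue′ stalled′ B⊆B′ A⊆B′ =
      Blue-resp-∼ p∼z (stalled-fill stalled′ (B⊆B′ p∈B) (B⊆B′ (blue-ext _ ∼-refl)) (mate₁-adj p)
                                     (A⊆B′ (x∈⁅x⁆ (mate₁ p))))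

  bridge : ∀ {S B u} → Progress S B → Clean B → Blue B u → ¬ Blue B (ext u) → Advanced B
  bridge {S} {B} {u} progress clean blue-u ¬blue-v =
    advance forcing stalled (⁅ a ⁆ ∪ ⁅ mate₁ d ⁆) affordable d∈X ¬blue-d blue′
    where
    open Progress progress
    v : Fin n
    v = ext u
    blue-ext-v : Blue B (ext v)
    blue-ext-v = subst (Blue B) (sym (ext-involutive u)) blue-u
    v∈B : v ∈ B
    v∈B = stalled⇒ext∈ stalled blue-u
    a : Fin n
    a = mate₁ v
    d : Fin n
    d = ext a
    d∈X : d ∈ X
    d∈X with meetsX⊎ext∈X a
    ... | inj₁ (z , a∼z , z∈X) =
      contradiction (clean v (z , ∼-trans (∼-mate₁ v) a∼z , z∈X) blue-ext-v) ¬blue-v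
    ... | inj₂ d∈X = d∈X
    ¬blue-d : ¬ Blue B d
    ¬blue-d blue-d = ¬blue-v (stalled-fill stalled v∈B (blue-ext-v _ ∼-refl) (mate₁-adj v)
                                (subst (_∈ B) (ext-involutive a) (stalled⇒ext∈ stalled blue-d)))
    affordable : ∣ ⁅ a ⁆ ∪ ⁅ mate₁ d ⁆ ∣ + ∣ S ∣ ≤ 3 + ∣ settled B ∣
    affordable = +-mono-≤ (∣⁅x⁆∪⁅y⁆∣≤2 a (mate₁ d)) (budget-clean clean)
    blue′ : ∀ {B′} → Stalled B′ → B ⊆ B′ → ⁅ a ⁆ ∪ ⁅ mate₁ d ⁆ ⊆ B′ → Blue B′ d
    blue′ {B′} stalled′ B⊆B′ A⊆B′ =
      stalled-fill stalled′ d∈B′ (subst (_∈ B′) (sym (ext-involutive a)) a∈B′) (mate₁-adj d)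
                   (A⊆B′ (x∈p∪q⁺ (inj₂ (x∈⁅x⁆ (mate₁ d)))))
      where
      a∈B′ : a ∈ B′
      a∈B′ = A⊆B′ (x∈p∪q⁺ (inj₁ (x∈⁅x⁆ a)))
      blue-v′ : Blue B′ v
      blue-v′ = stalled-fill stalled′ (B⊆B′ v∈B) (B⊆B′ (blue-ext-v _ ∼-refl)) (mate₁-adj v) a∈B′
      d∈B′ : d ∈ B′
      d∈B′ = stalled⇒ext∈ stalled′ (Blue-resp-∼ (∼-mate₁ v) blue-v′)

  exit-from-blue : ∀ {B w} → ∃ (Blue B) → w ∉ B → ∃ λ u → Blue B u × ¬ Blue B (ext u)
  exit-from-blue {B} {w} (c , blue-c) w∉B
    with crossing-edge (blue? B) (connected c w) blue-c (λ blue-w → w∉B (blue-w w ∼-refl))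
  ... | u , y , uy , blue-u , ¬blue-y with G-adj-cases uy
  ...   | inj₁ uy-in-H = contradiction (Blue-resp-∼ (inj₂ uy-in-H) blue-u) ¬blue-y
  ...   | inj₂ refl    = u , blue-u , ¬blue-y

  step : ∀ {S B} → Progress S B → (∀ v → v ∈ B) ⊎ Advanced B
  step {B = B} progress with all? (_∈? B) | clean-or-unclean B
  ... | yes all-blue | _ = inj₁ all-blue
  ... | no _ | inj₂ (p , meets , ¬blue , blue-ext) = inj₂ (absorb progress meets ¬blue blue-ext)
  ... | no ¬all-blue | inj₁ clean
    with exit-from-blue (Progress.some-blue progress) (proj₂ (¬∀⟶∃¬ n (_∈ B) (_∈? B) ¬all-blue))
  ...   | u , blue-u , ¬blue-ext = inj₂ (bridge progress clean blue-u ¬blue-ext)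

  finish : ∀ {S B} → Progress S B → (∀ v → v ∈ B) → ZeroForcing G S × ∣ S ∣ ≤ ∣ X ∣ + 1
  finish {S} progress all-blue =
    subst (S ⇒*_) (⊆-antisym ⊆⊤ (λ {v} _ → all-blue v)) forcing ,
    ≤-trans (budget-clean (λ _ _ _ u _ → all-blue u))
            (≤-trans (s≤s (∣p∩q∣≤∣p∣ X _)) (≤-reflexive (+-comm 1 ∣ X ∣)))
    where open Progress progress

  zero-forcing-bound : Fin n → ∃ λ S → ZeroForcing G S × ∣ S ∣ ≤ ∣ X ∣ + 1
  zero-forcing-bound w
    with climb potential n (∣p∣≤n ∘ settled ∘ proj₂) step (proj₂ (start (proj₂ (X-member w))))
  ... | (S , _) , progress , all-blue = S , finish progress all-blue

lemma2p6 : ∀ (n : ℕ) (G : Graph n) → Connected G → Cubic G →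
    HasTriangle2Factor G → ZBoundedByDomPlusOne G
lemma2p6 zero    G _         _     _                X _   = ⊥ , ε , z≤n
lemma2p6 (suc n) G connected cubic (F , triangles) X dom =
  Construction.zero-forcing-bound G connected cubic F triangles X dom zero
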